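{- Let $G$ be a graph with an even number $n\geq 2$ of vertices, and let $\overline{G}$ be its complement. If $\mathrm{mp}(G)+\mathrm{mp}(\overline{G})=n-1$, then $G$ is regular.
   Context: All graphs are finite, simple and undirected; $\overline{G}$ is the complement of $G$. A perfect matching is a set of edges covering every vertex exactly once; an almost-perfect matching is a set of edges covering every vertex except one exactly once and missing the remaining vertex. The matching preclusion number $\mathrm{mp}(G)$ is the minimum number of edges whose deletion leaves a graph with neither a perfect matching nor an almost-perfect matching ($\mathrm{mp}(G)=0$ if $G$ has neither). -}

module Defs where

open import Data.Bool using (Bool; true; false; not; _∧_; if_then_else_)
open import Data.Bool.Properties using (∧-comm)
open import Data.Nat using (ℕ; zero; suc; _+_; _≤_; _<ᵇ_)
open import Data.Fin using (Fin; toℕ; _≟_)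
open import Data.Fin.Properties using (≡-decSetoid)
open import Data.List using (List; map; allFin)
open import Data.Nat.ListAction using (sum)
open import Data.Product using (Σ; ∃; _×_; _,_)
open import Relation.Nullary using (¬_)
open import Relation.Nullary.Decidable using (⌊_⌋; yes; no)
open import Relation.Binary.PropositionalEquality using (_≡_; refl; sym; cong; cong₂)

record Graph (n : ℕ) : Set where
  field
    adj    : Fin n → Fin n → Bool
    adj-sym    : ∀ i j → adj i j ≡ adj j i
    adj-irrefl : ∀ i → adj i i ≡ false
open Graph public

private
  neq : ∀ {n} → Fin n → Fin n → Bool
  neq i j = not ⌊ i ≟ j ⌋

  neq-sym : ∀ {n} (i j : Fin n) → neq i j ≡ neq j i
  neq-sym i j with i ≟ j | j ≟ i
  ... | yes _ | yes _ = refl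
  ... | no _  | no _  = refl
  ... | yes p | no q  = Relation.Nullary.contradiction (sym p) q
    where import Relation.Nullary
  ... | no p  | yes q = Relation.Nullary.contradiction (sym q) p
    where import Relation.Nullary

  neq-irrefl : ∀ {n} (i : Fin n) → neq i i ≡ false
  neq-irrefl i with i ≟ i
  ... | yes _ = refl
  ... | no p  = Relation.Nullary.contradiction refl p
    where import Relation.Nullary

  comp-irrefl : ∀ {n} (G : Graph n) (i : Fin n) → not (adj G i i) ∧ neq i i ≡ false
  comp-irrefl G i rewrite neq-irrefl i = ∧-comm (not (adj G i i)) false

complement : ∀ {n} → Graph n → Graph n
complement G = record
  { adj        = λ i j → not (adj G i j) ∧ neq i j
  ; adj-sym    = λ i j → cong₂ _∧_ (cong not (adj-sym G i j)) (neq-sym i j)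
  ; adj-irrefl = comp-irrefl G
  }

_⊆G_ : ∀ {n} → Graph n → Graph n → Set
H ⊆G G = ∀ i j → adj H i j ≡ true → adj G i j ≡ true

𝟙 : Bool → ℕ
𝟙 true  = 1
𝟙 false = 0

countPairs : ∀ {n} → (Fin n → Fin n → Bool) → ℕ
countPairs {n} P =
  sum (map (λ i → sum (map (λ j → 𝟙 ((toℕ i <ᵇ toℕ j) ∧ P i j)) (allFin n))) (allFin n))

deleted : ∀ {n} → Graph n → Graph n → ℕ
deleted G H = countPairs (λ i j → adj G i j ∧ not (adj H i j))

degree : ∀ {n} → Graph n → Fin n → ℕ
degree {n} G v = sum (map (λ w → 𝟙 (adj G v w)) (allFin n))

Regular : ∀ {n} → Graph n → Set
Regular G = ∃ λ d → ∀ v → degree G v ≡ d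

CoveredOnce : ∀ {n} → Graph n → Fin n → Set
CoveredOnce M v = ∃ λ w → adj M v w ≡ true × (∀ w′ → adj M v w′ ≡ true → w′ ≡ w)

Missed : ∀ {n} → Graph n → Fin n → Set
Missed M v = ∀ w → adj M v w ≡ false

PerfectMatching : ∀ {n} → Graph n → Set
PerfectMatching {n} H = Σ (Graph n) λ M → M ⊆G H × (∀ v → CoveredOnce M v)

AlmostPerfectMatching : ∀ {n} → Graph n → Set
AlmostPerfectMatching {n} H = Σ (Graph n) λ M → M ⊆G H × Σ (Fin n) λ u →
  Missed M u × (∀ v → ¬ (v ≡ u) → CoveredOnce M v)

NoMatching : ∀ {n} → Graph n → Set
NoMatching H = ¬ PerfectMatching H × ¬ AlmostPerfectMatching H

-- m is the matching preclusion number of G: the minimum number of edges whose deletion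
-- leaves a graph with neither a perfect nor an almost-perfect matching
-- (deleting 0 edges when G already has neither, so mp(G) = 0 in that case).
IsMP : ∀ {n} → Graph n → ℕ → Set
IsMP {n} G m =
  (Σ (Graph n) λ H → H ⊆G G × deleted G H ≡ m × NoMatching H)
  × (∀ (H : Graph n) → H ⊆G G → NoMatching H → m ≤ deleted G H)

module Submission where

-- The key inequality is  mp(G) ≤ deg_G(v)  for every vertex v:
-- deleting the deg_G(v) edges at v isolates v, so no perfect matching survives, and
-- no almost-perfect matching exists at all on an even number of vertices, because a
-- matching covering all but one vertex has degree sum n - 1, which is odd, whereas
-- every degree sum is even by the handshake lemma.  Counting the deleted edges is
-- itself a handshake argument on the star of v, which has degree sum at most 2 deg(v).
-- Applying the inequality to G and to its complement and using
-- deg_G(v) + deg_Ḡ(v) = n - 1 = mp(G) + mp(Ḡ)  forces  deg_G(v) = mp(G)  for all v.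

open import Defs
open import Data.Nat using (ℕ; _+_; _∸_; _≤_; _*_)
open import Data.Product using (∃)
open import Relation.Binary.PropositionalEquality using (_≡_)

open import Data.Bool using (Bool; true; false; not; _∧_; T)
open import Data.Bool.Properties using (∧-comm)
open import Data.Fin using (Fin; zero; suc; toℕ; _≟_; punchIn)
open import Data.Fin.Properties using (toℕ-injective; punchInᵢ≢i)
open import Data.List using (map; allFin; tabulate)
open import Data.List.Properties using (map-tabulate)
open import Data.Nat using (_<_; _<ᵇ_; z≤n; s≤s)
open import Data.Nat.Properties
  using (+-0-commutativeMonoid; +-identityʳ; +-mono-≤; +-monoʳ-≤; +-cancelʳ-≤; ≤-trans; ≤-antisym;
         ≤-reflexive; ≮⇒≥; <-asym; <ᵇ⇒<; <⇒<ᵇ; *-cancelˡ-≤; even≢odd; module ≤-Reasoning)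
import Data.Nat.ListAction as List
open import Data.Product using (_,_)
open import Data.Unit using (tt)
open import Function using (_∘_)
open import Relation.Nullary using (¬_; yes; no; contradiction)
open import Relation.Nullary.Decidable using (⌊_⌋; isYes≗does; dec-true; dec-false)
open import Relation.Binary.PropositionalEquality
  using (_≢_; refl; sym; trans; cong; cong₂; subst; module ≡-Reasoning)

open import Algebra.Properties.CommutativeMonoid.Sum +-0-commutativeMonoid
  using (sum-syntax; sum-cong-≗; ∑-distrib-+; ∑-comm; sum-remove; sum-replicate-zero)

sum-allFin : ∀ {n} (f : Fin n → ℕ) → List.sum (map f (allFin n)) ≡ ∑[ i < n ] f i
sum-allFin {n} f = trans (cong List.sum (map-tabulate (λ i → i) f)) (sum-tabulate f)
  where
  sum-tabulate : ∀ {m} (g : Fin m → ℕ) → List.sum (tabulate g) ≡ ∑[ i < m ] g i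
  sum-tabulate {ℕ.zero}  g = refl
  sum-tabulate {ℕ.suc m} g = cong (g zero +_) (sum-tabulate (g ∘ suc))

∑-mono-≤ : ∀ {n} {f g : Fin n → ℕ} → (∀ i → f i ≤ g i) → ∑[ i < n ] f i ≤ ∑[ i < n ] g i
∑-mono-≤ {ℕ.zero}  f≤g = z≤n
∑-mono-≤ {ℕ.suc n} f≤g = +-mono-≤ (f≤g zero) (∑-mono-≤ (f≤g ∘ suc))

∑-ones : ∀ n → ∑[ i < n ] 1 ≡ n
∑-ones ℕ.zero    = refl
∑-ones (ℕ.suc n) = cong ℕ.suc (∑-ones n)

∑-point : ∀ {n} (f : Fin n → ℕ) (v : Fin n) → (∀ w → w ≢ v → f w ≡ 0) → ∑[ i < n ] f i ≡ f v
∑-point {ℕ.suc n} f v vanish = begin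
  ∑[ i < ℕ.suc n ] f i                 ≡⟨ sum-remove {i = v} f ⟩
  f v + ∑[ j < n ] f (punchIn v j)     ≡⟨ cong (f v +_) (sum-cong-≗ (λ j → vanish _ (punchInᵢ≢i v j))) ⟩
  f v + ∑[ j < n ] 0                   ≡⟨ cong (f v +_) (sum-replicate-zero n) ⟩
  f v + 0                              ≡⟨ +-identityʳ (f v) ⟩
  f v                                  ∎
  where open ≡-Reasoning

≟-refl : ∀ {n} (v : Fin n) → ⌊ v ≟ v ⌋ ≡ true
≟-refl v = trans (isYes≗does (v ≟ v)) (dec-true (v ≟ v) refl)

≟-≢ : ∀ {n} {v w : Fin n} → v ≢ w → ⌊ v ≟ w ⌋ ≡ false
≟-≢ {v = v} {w} v≢w = trans (isYes≗does (v ≟ w)) (dec-false (v ≟ w) v≢w)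

∑-at : ∀ {n} (v : Fin n) (b : Fin n → Bool) → ∑[ w < n ] 𝟙 (⌊ v ≟ w ⌋ ∧ b w) ≡ 𝟙 (b v)
∑-at v b = trans (∑-point _ v (λ w w≢v → cong (λ t → 𝟙 (t ∧ b w)) (≟-≢ (w≢v ∘ sym))))
                 (cong (λ t → 𝟙 (t ∧ b v)) (≟-refl v))

∑-indicator : ∀ {n} (v : Fin n) → ∑[ w < n ] 𝟙 ⌊ v ≟ w ⌋ ≡ 1
∑-indicator v = trans (∑-point _ v (λ w w≢v → cong 𝟙 (≟-≢ (w≢v ∘ sym)))) (cong 𝟙 (≟-refl v))

edges : ∀ {n} → Graph n → ℕ
edges G = countPairs (adj G)

degree-∑ : ∀ {n} (G : Graph n) (v : Fin n) → degree G v ≡ ∑[ w < n ] 𝟙 (adj G v w)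
degree-∑ G v = sum-allFin (λ w → 𝟙 (adj G v w))

_≺_ : ∀ {n} → Fin n → Fin n → Bool
i ≺ j = toℕ i <ᵇ toℕ j

edges-∑ : ∀ {n} (G : Graph n) → edges G ≡ ∑[ i < n ] ∑[ j < n ] 𝟙 ((i ≺ j) ∧ adj G i j)
edges-∑ {n} G = trans (sum-allFin (λ i → List.sum (map (A i) (allFin n)))) (sum-cong-≗ (λ i → sum-allFin (A i)))
  where
  A : Fin n → Fin n → ℕ
  A i j = 𝟙 ((i ≺ j) ∧ adj G i j)

≺-true : ∀ {n} (i j : Fin n) → (i ≺ j) ≡ true → toℕ i < toℕ j
≺-true i j i≺j = <ᵇ⇒< (toℕ i) (toℕ j) (subst T (sym i≺j) tt)

≺-false : ∀ {n} (i j : Fin n) → (i ≺ j) ≡ false → ¬ toℕ i < toℕ j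
≺-false i j i⊀j i<j with () ← subst T i⊀j (<⇒<ᵇ i<j)

adj-split : ∀ {n} (G : Graph n) (i j : Fin n) →
  𝟙 (adj G i j) ≡ 𝟙 ((i ≺ j) ∧ adj G i j) + 𝟙 ((j ≺ i) ∧ adj G j i)
adj-split G i j with i ≺ j in i≺j | j ≺ i in j≺i
... | true  | true  = contradiction (≺-true j i j≺i) (<-asym (≺-true i j i≺j))
... | true  | false = sym (+-identityʳ _)
... | false | true  = cong 𝟙 (adj-sym G i j)
... | false | false = cong 𝟙 (subst (λ k → adj G i k ≡ false) i≡j (adj-irrefl G i))
  where
  i≡j : i ≡ j
  i≡j = toℕ-injective (≤-antisym (≮⇒≥ (≺-false j i j≺i)) (≮⇒≥ (≺-false i j i≺j)))

handshake : ∀ {n} (G : Graph n) → ∑[ v < n ] degree G v ≡ 2 * edges G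
handshake {n} G = begin
  ∑[ v < n ] degree G v                                         ≡⟨ sum-cong-≗ (degree-∑ G) ⟩
  ∑[ i < n ] ∑[ j < n ] 𝟙 (adj G i j)                           ≡⟨ sum-cong-≗ (λ i → sum-cong-≗ (adj-split G i)) ⟩
  ∑[ i < n ] ∑[ j < n ] (A i j + A j i)                         ≡⟨ sum-cong-≗ (λ i → ∑-distrib-+ (A i) (λ j → A j i)) ⟩
  ∑[ i < n ] (∑[ j < n ] A i j + ∑[ j < n ] A j i)              ≡⟨ ∑-distrib-+ (λ i → ∑[ j < n ] A i j) (λ i → ∑[ j < n ] A j i) ⟩
  E + ∑[ i < n ] ∑[ j < n ] A j i                               ≡⟨ cong (E +_) (∑-comm (λ i j → A j i)) ⟩
  E + E                                                         ≡⟨ cong (E +_) (sym (+-identityʳ E)) ⟩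
  2 * E                                                         ≡⟨ cong (2 *_) (sym (edges-∑ G)) ⟩
  2 * edges G                                                   ∎
  where
  open ≡-Reasoning
  A : Fin n → Fin n → ℕ
  A i j = 𝟙 ((i ≺ j) ∧ adj G i j)
  E : ℕ
  E = ∑[ i < n ] ∑[ j < n ] A i j

degree-of-missed : ∀ {n} (M : Graph n) (u : Fin n) → Missed M u → degree M u ≡ 0
degree-of-missed {n} M u missed =
  trans (degree-∑ M u) (trans (sum-cong-≗ (cong 𝟙 ∘ missed)) (sum-replicate-zero n))

degree-of-covered : ∀ {n} (M : Graph n) (v : Fin n) → CoveredOnce M v → degree M v ≡ 1
degree-of-covered M v (w , vw∈M , unique) =
  trans (degree-∑ M v) (trans (∑-point _ w off-w) (cong 𝟙 vw∈M))
  where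
  off-w : ∀ x → x ≢ w → 𝟙 (adj M v x) ≡ 0
  off-w x x≢w with adj M v x in vx∈M
  ... | true  = contradiction (unique x vx∈M) x≢w
  ... | false = refl

-- An almost-perfect matching has degree sum n - 1, which is odd when n is even.
no-almost-perfect-matching : ∀ {n} (H : Graph n) → (∃ λ k → n ≡ 2 * k) → ¬ AlmostPerfectMatching H
no-almost-perfect-matching {n} H (k , n≡2k) (M , _ , u , u-missed , covered) =
  even≢odd k (edges M) (begin
    2 * k                                         ≡⟨ sym n≡2k ⟩
    n                                             ≡⟨ sym (∑-ones n) ⟩
    ∑[ w < n ] 1                                  ≡⟨ sum-cong-≗ (λ w → sym (one-each w)) ⟩
    ∑[ w < n ] (𝟙 ⌊ u ≟ w ⌋ + degree M w)         ≡⟨ ∑-distrib-+ (λ w → 𝟙 ⌊ u ≟ w ⌋) (degree M) ⟩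
    ∑[ w < n ] 𝟙 ⌊ u ≟ w ⌋ + ∑[ w < n ] degree M w ≡⟨ cong₂ _+_ (∑-indicator u) (handshake M) ⟩
    1 + 2 * edges M                               ∎)
  where
  open ≡-Reasoning
  one-each : ∀ w → 𝟙 ⌊ u ≟ w ⌋ + degree M w ≡ 1
  one-each w with u ≟ w
  ... | yes refl = cong (1 +_) (degree-of-missed M u u-missed)
  ... | no u≢w   = degree-of-covered M w (covered w (u≢w ∘ sym))

isolate : ∀ {n} → Graph n → Fin n → Graph n
isolate G v = record
  { adj        = λ i j → (not ⌊ v ≟ i ⌋ ∧ not ⌊ v ≟ j ⌋) ∧ adj G i j
  ; adj-sym    = λ i j → cong₂ _∧_ (∧-comm (not ⌊ v ≟ i ⌋) _) (adj-sym G i j)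
  ; adj-irrefl = λ i → trans (cong (_ ∧_) (adj-irrefl G i)) (∧-comm _ false)
  }

isolate-⊆ : ∀ {n} (G : Graph n) (v : Fin n) → isolate G v ⊆G G
isolate-⊆ G v i j e with not ⌊ v ≟ i ⌋ ∧ not ⌊ v ≟ j ⌋
... | true = e

-- v has no neighbour left, so it cannot be covered by a perfect matching.
no-perfect-matching : ∀ {n} (G : Graph n) (v : Fin n) → ¬ PerfectMatching (isolate G v)
no-perfect-matching G v (M , M⊆ , covered) with covered v
... | w , vw∈M , _ = contradiction (M⊆ v w vw∈M) isolated
  where
  isolated : ¬ adj (isolate G v) v w ≡ true
  isolated rewrite ≟-refl v = λ ()

-- The graph of the edges of G that are not edges of H; deleted G H counts its edges.
_∖_ : ∀ {n} → Graph n → Graph n → Graph n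
G ∖ H = record
  { adj        = λ i j → adj G i j ∧ not (adj H i j)
  ; adj-sym    = λ i j → cong₂ _∧_ (adj-sym G i j) (cong not (adj-sym H i j))
  ; adj-irrefl = λ i → cong (_∧ not (adj H i i)) (adj-irrefl G i)
  }

-- An edge deleted when isolating v has v as one of its endpoints.
star-indicator : ∀ a b c → 𝟙 (a ∧ not ((not b ∧ not c) ∧ a)) ≤ 𝟙 (b ∧ a) + 𝟙 (c ∧ a)
star-indicator false b     c     = z≤n
star-indicator true  true  c     = s≤s z≤n
star-indicator true  false true  = s≤s z≤n
star-indicator true  false false = z≤n

-- Isolating v deletes at most deg(v) edges: the deleted edges form the star of v,
-- whose degree sum is at most 2 deg(v).
deleted-isolate : ∀ {n} (G : Graph n) (v : Fin n) → deleted G (isolate G v) ≤ degree G v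
deleted-isolate {n} G v = *-cancelˡ-≤ 2 (begin
  2 * edges (G ∖ isolate G v)                            ≡⟨ sym (handshake (G ∖ isolate G v)) ⟩
  ∑[ u < n ] degree (G ∖ isolate G v) u                  ≤⟨ ∑-mono-≤ (λ u → ≤-trans (≤-reflexive (degree-∑ (G ∖ isolate G v) u))
                                                                                (∑-mono-≤ (star u))) ⟩
  ∑[ u < n ] ∑[ w < n ] (at-u u w + at-w u w)            ≡⟨ sum-cong-≗ (λ u → ∑-distrib-+ (at-u u) (at-w u)) ⟩
  ∑[ u < n ] (∑[ w < n ] at-u u w + ∑[ w < n ] at-w u w) ≡⟨ ∑-distrib-+ (λ u → ∑[ w < n ] at-u u w) (λ u → ∑[ w < n ] at-w u w) ⟩
  ∑[ u < n ] ∑[ w < n ] at-u u w + ∑[ u < n ] ∑[ w < n ] at-w u w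
                                                         ≡⟨ cong₂ _+_ (∑-comm at-u) (sum-cong-≗ (λ u → ∑-at v (adj G u))) ⟩
  ∑[ w < n ] ∑[ u < n ] at-u u w + ∑[ u < n ] 𝟙 (adj G u v)
                                                         ≡⟨ cong₂ _+_ (sum-cong-≗ (λ w → ∑-at v (λ u → adj G u w)))
                                                                      (sum-cong-≗ (λ u → cong 𝟙 (adj-sym G u v))) ⟩
  d + d                                                  ≡⟨ cong (d +_) (sym (+-identityʳ d)) ⟩
  2 * d                                                  ≡⟨ cong (2 *_) (sym (degree-∑ G v)) ⟩
  2 * degree G v                                         ∎)
  where
  open ≤-Reasoning
  d : ℕ
  d = ∑[ w < n ] 𝟙 (adj G v w)
  at-u at-w : Fin n → Fin n → ℕ
  at-u u w = 𝟙 (⌊ v ≟ u ⌋ ∧ adj G u w)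
  at-w u w = 𝟙 (⌊ v ≟ w ⌋ ∧ adj G u w)
  star : ∀ u w → 𝟙 (adj (G ∖ isolate G v) u w) ≤ at-u u w + at-w u w
  star u w = star-indicator (adj G u w) ⌊ v ≟ u ⌋ ⌊ v ≟ w ⌋

-- For even n, mp(G) ≤ deg(v): isolating v destroys all perfect and almost-perfect
-- matchings at the cost of at most deg(v) deleted edges.
mp-≤-degree : ∀ {n} (G : Graph n) {m : ℕ} → (∃ λ k → n ≡ 2 * k) → IsMP G m → ∀ v → m ≤ degree G v
mp-≤-degree G even (_ , minimal) v =
  ≤-trans (minimal (isolate G v) (isolate-⊆ G v)
                   (no-perfect-matching G v , no-almost-perfect-matching (isolate G v) even))
          (deleted-isolate G v)

-- Each vertex w ≠ v is adjacent to v in exactly one of G and its complement,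
-- so deg_G(v) + deg_Ḡ(v) = n - 1.
degree-complement : ∀ {n} (G : Graph n) (v : Fin n) → 1 + (degree G v + degree (complement G) v) ≡ n
degree-complement {n} G v = begin
  1 + (degree G v + degree (complement G) v)        ≡⟨ cong₂ (λ a b → 1 + (a + b)) (degree-∑ G v) (degree-∑ (complement G) v) ⟩
  1 + (∑[ w < n ] G-adj w + ∑[ w < n ] Ḡ-adj w)     ≡⟨ cong₂ _+_ (sym (∑-indicator v)) (sym (∑-distrib-+ G-adj Ḡ-adj)) ⟩
  ∑[ w < n ] 𝟙 ⌊ v ≟ w ⌋ + ∑[ w < n ] (G-adj w + Ḡ-adj w) ≡⟨ sym (∑-distrib-+ (λ w → 𝟙 ⌊ v ≟ w ⌋) (λ w → G-adj w + Ḡ-adj w)) ⟩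
  ∑[ w < n ] (𝟙 ⌊ v ≟ w ⌋ + (G-adj w + Ḡ-adj w))    ≡⟨ sum-cong-≗ exactly-one ⟩
  ∑[ w < n ] 1                                      ≡⟨ ∑-ones n ⟩
  n                                                 ∎
  where
  open ≡-Reasoning
  G-adj Ḡ-adj : Fin n → ℕ
  G-adj w = 𝟙 (adj G v w)
  Ḡ-adj w = 𝟙 (adj (complement G) v w)
  exactly-one : ∀ w → 𝟙 ⌊ v ≟ w ⌋ + (G-adj w + Ḡ-adj w) ≡ 1
  exactly-one w with v ≟ w
  ... | yes refl rewrite adj-irrefl G v = refl
  ... | no _ with adj G v w
  ...   | true  = refl
  ...   | false = refl

squeeze : ∀ {a b x y : ℕ} → a ≤ x → b ≤ y → x + y ≡ a + b → x ≡ a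
squeeze {a} {b} {x} {y} a≤x b≤y x+y≡a+b =
  ≤-antisym (+-cancelʳ-≤ y x a (subst (_≤ a + y) (sym x+y≡a+b) (+-monoʳ-≤ a b≤y))) a≤x

theorem5p5 : (n : ℕ) → (∃ λ k → n ≡ 2 * k) → 2 ≤ n → (G : Graph n) → (m₁ m₂ : ℕ) →
    IsMP G m₁ → IsMP (complement G) m₂ → m₁ + m₂ ≡ n ∸ 1 → Regular G
theorem5p5 n even _ G m₁ m₂ mp₁ mp₂ m₁+m₂≡n-1 = m₁ , degree≡m₁
  where
  degree≡m₁ : ∀ v → degree G v ≡ m₁
  degree≡m₁ v = squeeze (mp-≤-degree G even mp₁ v) (mp-≤-degree (complement G) even mp₂ v)
                        (trans (cong (_∸ 1) (degree-complement G v)) (sym m₁+m₂≡n-1))
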